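{- For every deterministic circular graph $G$, its common cycle language $\mathrm{L}_G$ is a stable language, i.e. for all words $u,v,w$ with $v\in\mathrm{L}_G$ one has $uvw\in\mathrm{L}_G\iff uw\in\mathrm{L}_G$.
   Context: A graph is a non-empty set $G\subseteq V\times A\times V$ of labelled edges $s\xrightarrow{a}t$ (for some label set $A$); $V_G$ is the set of vertices occurring in edges. $G$ is deterministic if $r\xrightarrow{a}s,\ r\xrightarrow{a}t\Rightarrow s=t$. For a word $u=a_1\cdots a_n\in A^*$, $s\xrightarrow{u}t$ means there is a path $s=s_0\xrightarrow{a_1}s_1\cdots\xrightarrow{a_n}s_n=t$ (the empty word labels the empty path from $s$ to $s$); $\mathrm{L}_G(s,s)=\{u\mid s\xrightarrow{u}s\}$. $G$ is circular if $\mathrm{L}_G(s,s)=\mathrm{L}_G(t,t)$ for all $s,t\in V_G$, and this common language is denoted $\mathrm{L}_G$. -}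

module Defs where

open import Level using (Level; _⊔_; suc)
open import Data.List using (List; []; _∷_; _++_)
open import Data.Product using (Σ; ∃; _×_; _,_)
open import Data.Sum using (_⊎_)
open import Relation.Binary.PropositionalEquality using (_≡_)
open import Function.Bundles using (_⇔_)

Graph : ∀ {v a} (V : Set v) (A : Set a) (ℓ : Level) → Set (v ⊔ a ⊔ suc ℓ)
Graph V A ℓ = V → A → V → Set ℓ

module _ {v a ℓ} {V : Set v} {A : Set a} (G : Graph V A ℓ) where

  NonEmpty : Set (v ⊔ a ⊔ ℓ)
  NonEmpty = Σ V λ s → Σ A λ x → Σ V λ t → G s x t

  -- V_G : vertices occurring in some edge (as source or target)
  InV : V → Set (v ⊔ a ⊔ ℓ)
  InV s = (Σ A λ x → Σ V λ t → G s x t) ⊎ (Σ V λ r → Σ A λ x → G r x s)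

  Deterministic : Set (v ⊔ a ⊔ ℓ)
  Deterministic = ∀ {r x s t} → G r x s → G r x t → s ≡ t

  data Path : V → List A → V → Set (v ⊔ a ⊔ ℓ) where
    [] : ∀ {s} → Path s [] s
    _∷_ : ∀ {s x t w r} → G s x t → Path t w r → Path s (x ∷ w) r

  Loop : V → List A → Set (v ⊔ a ⊔ ℓ)
  Loop s u = Path s u s

  Circular : Set (v ⊔ a ⊔ ℓ)
  Circular = ∀ {s t} → InV s → InV t → ∀ u → Loop s u ⇔ Loop t u

Stable : ∀ {a ℓ} {A : Set a} → (List A → Set ℓ) → Set (a ⊔ ℓ)
Stable L = ∀ u v w → L v → (L (u ++ v ++ w) ⇔ L (u ++ w))

-- In a deterministic graph a word labels at most one path from a given vertex.
-- Circularity makes every v ∈ L_G a loop at the vertex p reached from s by u,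
-- so the unique path labelled u v w from s goes s -u-> p -v-> p -w-> s, and
-- deleting or inserting the loop v at p turns it into a path labelled u w.
module Submission where

open import Defs
open import Data.List using (List; []; _∷_; _++_)
open import Data.Product using (Σ; _×_; _,_)
open import Data.Sum using (inj₂)
open import Relation.Binary.PropositionalEquality using (_≡_; refl; subst)
open import Function.Bundles using (mk⇔; Equivalence)

module _ {v a ℓ} {V : Set v} {A : Set a} (G : Graph V A ℓ) where

  Path-++⁺ : ∀ {s p t u w} → Path G s u p → Path G p w t → Path G s (u ++ w) t
  Path-++⁺ []      q = q
  Path-++⁺ (e ∷ p) q = e ∷ Path-++⁺ p q

  Path-++⁻ : ∀ {s t} u {w} → Path G s (u ++ w) t →
             Σ V λ p → Path G s u p × Path G p w t
  Path-++⁻ []      q       = _ , [] , q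
  Path-++⁻ (x ∷ u) (e ∷ q) with Path-++⁻ u q
  ... | p , qu , qw = p , e ∷ qu , qw

  Path-InV : ∀ {s t u} → Path G s u t → InV G s → InV G t
  Path-InV []                i = i
  Path-InV (_∷_ {s} {x} e p) _ = Path-InV p (inj₂ (s , x , e))

  Path-deterministic : Deterministic G →
                       ∀ {s t t′ u} → Path G s u t → Path G s u t′ → t ≡ t′
  Path-deterministic det []      []        = refl
  Path-deterministic det (e ∷ p) (e′ ∷ p′) with det e e′
  ... | refl = Path-deterministic det p p′

  Loop-cancel : Deterministic G → ∀ {p t v w} →
                Loop G p v → Path G p (v ++ w) t → Path G p w t
  Loop-cancel det {v = v} loop q with Path-++⁻ v q
  ... | _ , qv , qw = subst (λ p → Path G p _ _)
                            (Path-deterministic det qv loop) qw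

  Circular-Loop : Circular G → ∀ {s p u v} → InV G s →
                  Path G s u p → Loop G s v → Loop G p v
  Circular-Loop circ {v = v} i q = Equivalence.to (circ i (Path-InV q i) v)

lemma4p3 : ∀ {v a ℓ} {V : Set v} {A : Set a} (G : Graph V A ℓ)
           → NonEmpty G → Deterministic G → Circular G
           → (s : V) → InV G s
           → Stable (Loop G s)
lemma4p3 G _ det circ s i u v w loop = mk⇔ delete insert
  where
  delete : Loop G s (u ++ v ++ w) → Loop G s (u ++ w)
  delete q with Path-++⁻ G u q
  ... | _ , qu , qvw =
    Path-++⁺ G qu (Loop-cancel G det (Circular-Loop G circ i qu loop) qvw)

  insert : Loop G s (u ++ w) → Loop G s (u ++ v ++ w)
  insert q with Path-++⁻ G u q
  ... | _ , qu , qw =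
    Path-++⁺ G qu (Path-++⁺ G (Circular-Loop G circ i qu loop) qw)
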